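{- Let $a,b,c\in\mathbb{Z}$ with $a,b$ odd, $c\equiv 2\pmod 4$, and $ab(a+b)c$ a nonzero perfect square. If the equation $ax^2+by^2=cz^2$ is partition regular with respect to $x,y$ (for every finite coloring of $\mathbb{N}$ there exist distinct $x,y\in\mathbb{N}$ of the same color and $z\in\mathbb{N}$ solving it), then $ab\equiv 1\pmod 8$. -}

module Defs where

open import Data.Nat as ℕ using (ℕ)
open import Data.Fin using (Fin)
open import Data.Integer using (ℤ; +_; _+_; _*_; _-_)
open import Data.Integer.Divisibility using (_∣_)
open import Data.Product using (Σ; ∃; _×_)
open import Relation.Binary.PropositionalEquality using (_≡_; _≢_)
open import Relation.Nullary using (¬_)

Odd : ℤ → Set
Odd a = ¬ (+ 2 ∣ a)

CongMod : ℤ → ℤ → ℤ → Set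
CongMod m a b = m ∣ (a - b)

NonzeroSquare : ℤ → Set
NonzeroSquare n = (n ≢ + 0) × ∃ λ (m : ℤ) → n ≡ m * m

Solves : ℤ → ℤ → ℤ → ℕ → ℕ → ℕ → Set
Solves a b c x y z =
  a * (+ x * + x) + b * (+ y * + y) ≡ c * (+ z * + z)

-- Partition regularity w.r.t. x, y over the positive integers
-- ℕ = {1,2,3,...}: for every finite colouring χ (with k colours) there exist
-- distinct positive x, y of the same colour and a positive z solving the equation.
-- (Colourings are given on all of Agda's ℕ; the value at 0 is irrelevant.)
PartitionRegularXY : ℤ → ℤ → ℤ → Set
PartitionRegularXY a b c =
  (k : ℕ) (χ : ℕ → Fin k) →
  ∃ λ x → ∃ λ y → ∃ λ z →
    (1 ℕ.≤ x) × (1 ℕ.≤ y) × (1 ℕ.≤ z) × (x ≢ y) × (χ x ≡ χ y) × Solves a b c x y z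

-- Write c = 2c′ and a + b = 2^e A with c′, A odd, and colour a positive integer 2^k u (u odd) by
-- u mod 2^(e+2). In a monochromatic solution x = 2^k u, y = 2^l w, z = 2^j t, the 2-adic
-- valuation of a x² + b y² is even when k ≠ l, while that of 2c′z² is odd; so k = l. Then
-- w ≡ u (mod 2^(e+2)) gives a u² + b w² = 2^e (A u² + 8S), and comparing odd parts yields
-- A u² + 8S = c′ t², hence A ≡ c′ (mod 8) because odd squares are 1 mod 8. Finally
-- ab(a+b)c = 2^(e+1) abAc′ is a square, so abAc′ is an odd square, abAc′ ≡ 1 (mod 8),
-- and ab ≡ ab c′² ≡ abAc′ ≡ 1 (mod 8).
module Submission where

open import Defs
open import Data.Fin using (Fin; fromℕ<)
open import Data.Fin.Properties using (fromℕ<-injective)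
open import Data.Integer using (ℤ; +_; 0ℤ; _+_; _*_; _-_; ∣_∣; _^_; NonZero; ≢-nonZero)
open import Data.Integer.Properties
  using (+-comm; *-assoc; *-identityˡ; *-cancelˡ-≡; abs-*; ∣i∣≡0⇒i≡0; ^-distribˡ-+-*; i^n≡0⇒i≡0)
open import Data.Integer.DivMod using (_%_; _/_; n%d<d; a≡a%n+[a/n]*n)
import Data.Integer.Divisibility as Unsigned
open import Data.Integer.Divisibility.Signed
  using (_∣_; divides; ∣ᵤ⇒∣; ∣⇒∣ᵤ; ∣-refl; ∣m⇒∣m*n; ∣n⇒∣m*n; ∣m+n∣n⇒∣m; ∣m∣n⇒∣m+n; ∣m∣n⇒∣m-n)
open import Data.Integer.Tactic.RingSolver using (solve-∀)
open import Data.Nat as ℕ using (ℕ; zero; suc; z≤n; s≤s)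
import Data.Nat.Properties as ℕ
import Data.Nat.Divisibility as ℕ
open import Data.Nat.Induction using (<-wellFounded)
open import Data.Nat.Primality using (euclidsLemma; prime[2])
open import Data.Product using (∃-syntax; _×_; _,_; proj₁; proj₂)
open import Data.Sum using (_⊎_; inj₁; inj₂)
open import Induction.WellFounded using (Acc; acc)
open import Relation.Binary.Definitions using (tri<; tri≈; tri>)
open import Relation.Binary.PropositionalEquality
open import Relation.Nullary using (¬_; contradiction)

-- `+ 2 ^ k` parses as `+ (2 ^ k)`.
2ℤ : ℤ
2ℤ = + 2

infix 9 _²
_² : ℤ → ℤ
x ² = x * x

even⊎odd : ∀ i → (∃[ m ] i ≡ + 2 * m) ⊎ (∃[ m ] i ≡ + 1 + + 2 * m)
even⊎odd i with i % + 2 | n%d<d i (+ 2) | a≡a%n+[a/n]*n i (+ 2)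
... | 0 | _ | eq = inj₁ (i / + 2 , trans eq (rearrange (i / + 2)))
  where rearrange : ∀ m → + 0 + m * + 2 ≡ + 2 * m
        rearrange = solve-∀
... | 1 | _ | eq = inj₂ (i / + 2 , trans eq (rearrange (i / + 2)))
  where rearrange : ∀ m → + 1 + m * + 2 ≡ + 1 + + 2 * m
        rearrange = solve-∀
... | suc (suc _) | s≤s (s≤s ()) | _

2∣2* : ∀ m → + 2 Unsigned.∣ + 2 * m
2∣2* m = ∣⇒∣ᵤ (∣m⇒∣m*n {+ 2} m ∣-refl)

2*-not-odd : ∀ {i} m → i ≡ + 2 * m → ¬ Odd i
2*-not-odd m refl odd = odd (2∣2* m)

odd-* : ∀ {i j} → Odd i → Odd j → Odd (i * j)
odd-* {i} {j} odd-i odd-j 2∣ij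
  with euclidsLemma ∣ i ∣ ∣ j ∣ prime[2] (subst (2 ℕ.∣_) (abs-* i j) 2∣ij)
... | inj₁ 2∣i = odd-i 2∣i
... | inj₂ 2∣j = odd-j 2∣j

odd-² : ∀ {i} → Odd i → Odd (i ²)
odd-² {i} odd-i = odd-* {i} {i} odd-i odd-i

odd-+-even : ∀ {i j} → Odd i → + 2 ∣ j → Odd (i + j)
odd-+-even {i} {j} odd-i 2∣j 2∣i+j =
  odd-i (∣⇒∣ᵤ (∣m+n∣n⇒∣m {+ 2} {i} {j} (∣ᵤ⇒∣ 2∣i+j) 2∣j))

1+2*-odd : ∀ m → Odd (+ 1 + + 2 * m)
1+2*-odd m = odd-+-even {+ 1} {+ 2 * m} odd-1 (∣ᵤ⇒∣ (2∣2* m))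
  where
  odd-1 : Odd (+ 1)
  odd-1 2∣1 = contradiction (ℕ.∣1⇒≡1 2∣1) λ ()

odd⇒≡1+2* : ∀ {i} → Odd i → ∃[ m ] i ≡ + 1 + + 2 * m
odd⇒≡1+2* {i} odd with even⊎odd i
... | inj₁ (m , refl) = contradiction (2∣2* m) odd
... | inj₂ i≡1+2m = i≡1+2m

odd²≡1[mod8] : ∀ {i} → Odd i → + 8 ∣ i ² - + 1
odd²≡1[mod8] {i} odd with odd⇒≡1+2* {i} odd
... | m , refl with even⊎odd m
...   | inj₁ (k , refl) = divides (k + + 2 * k * k) (expand k)
  where expand : ∀ k → (+ 1 + + 2 * (+ 2 * k)) * (+ 1 + + 2 * (+ 2 * k)) - + 1 ≡
                       (k + + 2 * k * k) * + 8
        expand = solve-∀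
...   | inj₂ (k , refl) = divides (+ 1 + + 3 * k + + 2 * k * k) (expand k)
  where expand : ∀ k → (+ 1 + + 2 * (+ 1 + + 2 * k)) * (+ 1 + + 2 * (+ 1 + + 2 * k)) - + 1 ≡
                       (+ 1 + + 3 * k + + 2 * k * k) * + 8
        expand = solve-∀

record TwoAdic (n : ℤ) : Set where
  constructor mkTwoAdic
  field
    exponent : ℕ
    oddPart  : ℤ
    oddPart-odd : Odd oddPart
    n≡2^e*q  : n ≡ 2ℤ ^ exponent * oddPart

2^*odd-injective : ∀ i j {q r} → Odd q → Odd r →
  2ℤ ^ i * q ≡ 2ℤ ^ j * r → i ≡ j × q ≡ r
2^*odd-injective zero zero {q} {r} _ _ eq =
  refl , trans (sym (*-identityˡ q)) (trans eq (*-identityˡ r))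
2^*odd-injective zero (suc j) {q} {r} odd-q _ eq =
  contradiction odd-q (2*-not-odd (2ℤ ^ j * r)
    (trans (sym (*-identityˡ q)) (trans eq (*-assoc (+ 2) (2ℤ ^ j) r))))
2^*odd-injective (suc i) zero {q} {r} _ odd-r eq =
  contradiction odd-r (2*-not-odd (2ℤ ^ i * q)
    (trans (sym (*-identityˡ r)) (trans (sym eq) (*-assoc (+ 2) (2ℤ ^ i) q))))
2^*odd-injective (suc i) (suc j) {q} {r} odd-q odd-r eq
  with 2^*odd-injective i j odd-q odd-r
         (*-cancelˡ-≡ (+ 2) _ _ (trans (sym (*-assoc (+ 2) (2ℤ ^ i) q))
                                (trans eq (*-assoc (+ 2) (2ℤ ^ j) r))))
... | refl , q≡r = refl , q≡r

twoAdic : ∀ n → n ≢ 0ℤ → TwoAdic n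
twoAdic n n≢0 = go n n≢0 (<-wellFounded ∣ n ∣)
  where
  go : ∀ n → n ≢ 0ℤ → Acc ℕ._<_ ∣ n ∣ → TwoAdic n
  go n n≢0 (acc rs) with even⊎odd n
  ... | inj₂ (m , refl) = mkTwoAdic 0 n (1+2*-odd m) (sym (*-identityˡ n))
  ... | inj₁ (m , refl) =
    let mkTwoAdic e q odd-q m≡2^e*q = go m m≢0 (rs ∣m∣<∣2m∣)
    in  mkTwoAdic (suc e) q odd-q
          (trans (cong (+ 2 *_) m≡2^e*q) (sym (*-assoc (+ 2) (2ℤ ^ e) q)))
    where
    m≢0 : m ≢ 0ℤ
    m≢0 refl = n≢0 refl
    ∣m∣<∣2m∣ : ∣ m ∣ ℕ.< ∣ + 2 * m ∣
    ∣m∣<∣2m∣ = subst (∣ m ∣ ℕ.<_) (trans (ℕ.*-comm ∣ m ∣ 2) (sym (abs-* (+ 2) m)))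
      (ℕ.m<m*n ∣ m ∣ 2 {{ℕ.≢-nonZero (λ ∣m∣≡0 → m≢0 (∣i∣≡0⇒i≡0 ∣m∣≡0))}} (s≤s (s≤s z≤n)))

square-2^* : ∀ k u → (2ℤ ^ k * u) ² ≡ 2ℤ ^ (2 ℕ.* k) * u ²
square-2^* k u = begin
  (2ℤ ^ k * u) ²             ≡⟨ regroup (2ℤ ^ k) u ⟩
  2ℤ ^ k * 2ℤ ^ k * u ²      ≡⟨ cong (_* u ²) (^-distribˡ-+-* 2ℤ k k) ⟨
  2ℤ ^ (k ℕ.+ k) * u ²       ≡⟨ cong (λ n → 2ℤ ^ (k ℕ.+ n) * u ²) (ℕ.+-identityʳ k) ⟨
  2ℤ ^ (2 ℕ.* k) * u ²       ∎
  where
  open ≡-Reasoning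
  regroup : ∀ p u → (p * u) * (p * u) ≡ p * p * (u * u)
  regroup = solve-∀

2*square-2^* : ∀ c k t → + 2 * c * (2ℤ ^ k * t) ² ≡ 2ℤ ^ suc (2 ℕ.* k) * (c * t ²)
2*square-2^* c k t = begin
  + 2 * c * (2ℤ ^ k * t) ²           ≡⟨ cong (+ 2 * c *_) (square-2^* k t) ⟩
  + 2 * c * (2ℤ ^ (2 ℕ.* k) * t ²)   ≡⟨ regroup c (2ℤ ^ (2 ℕ.* k)) (t ²) ⟩
  + 2 * 2ℤ ^ (2 ℕ.* k) * (c * t ²)   ∎
  where
  open ≡-Reasoning
  regroup : ∀ c p s → + 2 * c * (p * s) ≡ + 2 * p * (c * s)
  regroup = solve-∀

sum-of-squares-2^* : ∀ a b k u v →
  a * (2ℤ ^ k * u) ² + b * (2ℤ ^ k * v) ² ≡ 2ℤ ^ (2 ℕ.* k) * (a * u ² + b * v ²)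
sum-of-squares-2^* a b k u v = begin
  a * (2ℤ ^ k * u) ² + b * (2ℤ ^ k * v) ²
    ≡⟨ cong₂ (λ x y → a * x + b * y) (square-2^* k u) (square-2^* k v) ⟩
  a * (2ℤ ^ (2 ℕ.* k) * u ²) + b * (2ℤ ^ (2 ℕ.* k) * v ²)
    ≡⟨ factor a b (2ℤ ^ (2 ℕ.* k)) (u ²) (v ²) ⟩
  2ℤ ^ (2 ℕ.* k) * (a * u ² + b * v ²) ∎
  where
  open ≡-Reasoning
  factor : ∀ a b p s t → a * (p * s) + b * (p * t) ≡ p * (a * s + b * t)
  factor = solve-∀

unbalanced-sum-of-squares : ∀ a b u w k d → Odd a → Odd u →
  ∃[ q ] Odd q × a * (2ℤ ^ k * u) ² + b * (2ℤ ^ (suc k ℕ.+ d) * w) ² ≡ 2ℤ ^ (2 ℕ.* k) * q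
unbalanced-sum-of-squares a b u w k d odd-a odd-u =
  a * u ² + b * v ² , odd-+-even {a * u ²} (odd-* {a} {u ²} odd-a (odd-² {u} odd-u)) 2∣bv² , (begin
    a * (2ℤ ^ k * u) ² + b * (2ℤ ^ (suc k ℕ.+ d) * w) ²
      ≡⟨ cong (λ y → a * (2ℤ ^ k * u) ² + b * y ²) 2^[1+k+d]w≡2^k*v ⟩
    a * (2ℤ ^ k * u) ² + b * (2ℤ ^ k * v) ²
      ≡⟨ sum-of-squares-2^* a b k u v ⟩
    2ℤ ^ (2 ℕ.* k) * (a * u ² + b * v ²) ∎)
  where
  open ≡-Reasoning
  v : ℤ
  v = + 2 * (2ℤ ^ d * w)
  regroup : ∀ p q w → + 2 * (p * q) * w ≡ p * (+ 2 * (q * w))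
  regroup = solve-∀
  2^[1+k+d]w≡2^k*v : 2ℤ ^ (suc k ℕ.+ d) * w ≡ 2ℤ ^ k * v
  2^[1+k+d]w≡2^k*v =
    trans (cong (λ p → + 2 * p * w) (^-distribˡ-+-* 2ℤ k d)) (regroup (2ℤ ^ k) (2ℤ ^ d) w)
  2∣bv² : + 2 ∣ b * v ²
  2∣bv² = ∣n⇒∣m*n b (∣m⇒∣m*n v (∣m⇒∣m*n (2ℤ ^ d * w) ∣-refl))

unbalanced-solution-impossible : ∀ a b c u w t k d j → Odd a → Odd c → Odd u → Odd t →
  a * (2ℤ ^ k * u) ² + b * (2ℤ ^ (suc k ℕ.+ d) * w) ² ≢ + 2 * c * (2ℤ ^ j * t) ²
unbalanced-solution-impossible a b c u w t k d j odd-a odd-c odd-u odd-t eq =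
  let q , odd-q , lhs≡2^2kq = unbalanced-sum-of-squares a b u w k d odd-a odd-u
  in  ℕ.even≢odd k j (proj₁ (2^*odd-injective (2 ℕ.* k) (suc (2 ℕ.* j)) odd-q odd-ct²
        (trans (sym lhs≡2^2kq) (trans eq (2*square-2^* c j t)))))
  where
  odd-ct² : Odd (c * t ²)
  odd-ct² = odd-* {c} {t ²} odd-c (odd-² {t} odd-t)

solution-exponents-equal : ∀ a b c u w t k l j →
  Odd a → Odd b → Odd c → Odd u → Odd w → Odd t →
  a * (2ℤ ^ k * u) ² + b * (2ℤ ^ l * w) ² ≡ + 2 * c * (2ℤ ^ j * t) ² → k ≡ l
solution-exponents-equal a b c u w t k l j odd-a odd-b odd-c odd-u odd-w odd-t eq
  with ℕ.<-cmp k l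
... | tri≈ _ k≡l _ = k≡l
... | tri< k<l _ _ with ℕ.m≤n⇒∃[o]m+o≡n k<l
...   | d , refl =
  contradiction eq (unbalanced-solution-impossible a b c u w t k d j odd-a odd-c odd-u odd-t)
solution-exponents-equal a b c u w t k l j odd-a odd-b odd-c odd-u odd-w odd-t eq
    | tri> _ _ l<k with ℕ.m≤n⇒∃[o]m+o≡n l<k
...   | d , refl =
  contradiction (trans (+-comm (b * (2ℤ ^ l * w) ²) (a * (2ℤ ^ (suc l ℕ.+ d) * u) ²)) eq)
                (unbalanced-solution-impossible b a c w u t l d j odd-b odd-c odd-w odd-t)

balanced-sum-of-squares : ∀ a b e A u w → a + b ≡ 2ℤ ^ e * A → 2ℤ ^ (2 ℕ.+ e) ∣ w - u →
  ∃[ S ] a * u ² + b * w ² ≡ 2ℤ ^ e * (A * u ² + + 8 * S)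
balanced-sum-of-squares a b e A u w a+b≡2^eA (divides m w-u≡m*2^[2+e]) = S , (begin
  a * u ² + b * w ²                        ≡⟨ cong (λ w → a * u ² + b * w ²) w≡u+m*4E ⟩
  a * u ² + b * (u + m * (+ 4 * E)) ²      ≡⟨ expand a b u m E ⟩
  (a + b) * u ² + E * (+ 8 * S)            ≡⟨ cong (λ s → s * u ² + E * (+ 8 * S)) a+b≡2^eA ⟩
  E * A * u ² + E * (+ 8 * S)              ≡⟨ factor E A (u ²) (+ 8 * S) ⟩
  E * (A * u ² + + 8 * S)                  ∎)
  where
  open ≡-Reasoning
  E = 2ℤ ^ e
  S = b * (u * m + + 2 * E * m * m)
  w≡u+[w-u] : ∀ w u → w ≡ u + (w - u)
  w≡u+[w-u] = solve-∀
  w≡u+m*4E : w ≡ u + m * (+ 4 * E)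
  w≡u+m*4E = trans (w≡u+[w-u] w u)
    (cong (λ d → u + d) (trans w-u≡m*2^[2+e] (cong (m *_) (sym (*-assoc (+ 2) (+ 2) E)))))
  expand : ∀ a b u m E → a * (u * u) + b * ((u + m * (+ 4 * E)) * (u + m * (+ 4 * E))) ≡
                         (a + b) * (u * u) + E * (+ 8 * (b * (u * m + + 2 * E * m * m)))
  expand = solve-∀
  factor : ∀ E A s t → E * A * s + E * t ≡ E * (A * s + t)
  factor = solve-∀

balanced-solution⇒odd-parts-equal : ∀ a b c A u w t e k j S → Odd c → Odd A → Odd u → Odd t →
  a * u ² + b * w ² ≡ 2ℤ ^ e * (A * u ² + + 8 * S) →
  a * (2ℤ ^ k * u) ² + b * (2ℤ ^ k * w) ² ≡ + 2 * c * (2ℤ ^ j * t) ² →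
  A * u ² + + 8 * S ≡ c * t ²
balanced-solution⇒odd-parts-equal a b c A u w t e k j S odd-c odd-A odd-u odd-t au²+bw²≡ eq =
  proj₂ (2^*odd-injective (2 ℕ.* k ℕ.+ e) (suc (2 ℕ.* j)) odd-Au²+8S odd-ct² (begin
    2ℤ ^ (2 ℕ.* k ℕ.+ e) * (A * u ² + + 8 * S)
      ≡⟨ cong (_* (A * u ² + + 8 * S)) (^-distribˡ-+-* 2ℤ (2 ℕ.* k) e) ⟩
    2ℤ ^ (2 ℕ.* k) * 2ℤ ^ e * (A * u ² + + 8 * S)
      ≡⟨ *-assoc (2ℤ ^ (2 ℕ.* k)) (2ℤ ^ e) (A * u ² + + 8 * S) ⟩
    2ℤ ^ (2 ℕ.* k) * (2ℤ ^ e * (A * u ² + + 8 * S))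
      ≡⟨ cong (2ℤ ^ (2 ℕ.* k) *_) au²+bw²≡ ⟨
    2ℤ ^ (2 ℕ.* k) * (a * u ² + b * w ²)
      ≡⟨ sum-of-squares-2^* a b k u w ⟨
    a * (2ℤ ^ k * u) ² + b * (2ℤ ^ k * w) ²
      ≡⟨ eq ⟩
    + 2 * c * (2ℤ ^ j * t) ²
      ≡⟨ 2*square-2^* c j t ⟩
    2ℤ ^ suc (2 ℕ.* j) * (c * t ²) ∎))
  where
  open ≡-Reasoning
  odd-Au²+8S : Odd (A * u ² + + 8 * S)
  odd-Au²+8S = odd-+-even {A * u ²} {+ 8 * S} (odd-* {A} {u ²} odd-A (odd-² {u} odd-u))
                 (∣m⇒∣m*n S (divides (+ 4) refl))
  odd-ct² : Odd (c * t ²)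
  odd-ct² = odd-* {c} {t ²} odd-c (odd-² {t} odd-t)

cancel-odd-squares[mod8] : ∀ A c u t S → Odd u → Odd t →
  A * u ² + + 8 * S ≡ c * t ² → + 8 ∣ c - A
cancel-odd-squares[mod8] A c u t S odd-u odd-t eq =
  subst (+ 8 ∣_) (regroup A c (u ²) (t ²))
    (∣m∣n⇒∣m+n (∣m∣n⇒∣m-n 8∣ct²-Au² (∣n⇒∣m*n c (odd²≡1[mod8] {t} odd-t)))
               (∣n⇒∣m*n A (odd²≡1[mod8] {u} odd-u)))
  where
  regroup : ∀ A c x y → c * y - A * x - c * (y - + 1) + A * (x - + 1) ≡ c - A
  regroup = solve-∀
  cancel : ∀ x S → x + + 8 * S - x ≡ S * + 8
  cancel = solve-∀
  8∣ct²-Au² : + 8 ∣ c * t ² - A * u ²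
  8∣ct²-Au² = divides S (trans (cong (_- A * u ²) (sym eq)) (cancel (A * u ²) S))

solution⇒c≡A[mod8] : ∀ a b c A u w t e k l j →
  Odd a → Odd b → Odd c → Odd A → Odd u → Odd w → Odd t →
  a + b ≡ 2ℤ ^ e * A → 2ℤ ^ (2 ℕ.+ e) ∣ w - u →
  a * (2ℤ ^ k * u) ² + b * (2ℤ ^ l * w) ² ≡ + 2 * c * (2ℤ ^ j * t) ² → + 8 ∣ c - A
solution⇒c≡A[mod8] a b c A u w t e k l j
  odd-a odd-b odd-c odd-A odd-u odd-w odd-t a+b≡2^eA 2^[2+e]∣w-u eq =
  let S , au²+bw²≡ = balanced-sum-of-squares a b e A u w a+b≡2^eA 2^[2+e]∣w-u
  in  cancel-odd-squares[mod8] A c u t S odd-u odd-t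
        (balanced-solution⇒odd-parts-equal a b c A u w t e k j S
          odd-c odd-A odd-u odd-t au²+bw²≡ balanced)
  where
  k≡l : k ≡ l
  k≡l = solution-exponents-equal a b c u w t k l j odd-a odd-b odd-c odd-u odd-w odd-t eq
  balanced : a * (2ℤ ^ k * u) ² + b * (2ℤ ^ k * w) ² ≡ + 2 * c * (2ℤ ^ j * t) ²
  balanced = subst (λ l → a * (2ℤ ^ k * u) ² + b * (2ℤ ^ l * w) ² ≡ + 2 * c * (2ℤ ^ j * t) ²)
                   (sym k≡l) eq

residue : (d : ℤ) .{{_ : NonZero d}} → ℤ → Fin ∣ d ∣
residue d i = fromℕ< (n%d<d i d)

residue-≡⇒∣ : ∀ d .{{_ : NonZero d}} i j → residue d i ≡ residue d j → d ∣ j - i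
residue-≡⇒∣ d i j r≡r = divides (j / d - i / d) (begin
  j - i
    ≡⟨ cong₂ _-_ (a≡a%n+[a/n]*n j d) (a≡a%n+[a/n]*n i d) ⟩
  (+ (j % d) + j / d * d) - (+ (i % d) + i / d * d)
    ≡⟨ cong (λ r → (+ r + j / d * d) - (+ (i % d) + i / d * d)) j%d≡i%d ⟩
  (+ (i % d) + j / d * d) - (+ (i % d) + i / d * d)
    ≡⟨ cancel (+ (i % d)) (j / d) (i / d) d ⟩
  (j / d - i / d) * d ∎)
  where
  open ≡-Reasoning
  j%d≡i%d : j % d ≡ i % d
  j%d≡i%d = sym (fromℕ<-injective (i % d) (j % d) (n%d<d i d) (n%d<d j d) r≡r)
  cancel : ∀ r p q d → (r + p * d) - (r + q * d) ≡ (p - q) * d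
  cancel = solve-∀

2^-nonZero : ∀ n → NonZero (2ℤ ^ n)
2^-nonZero n = ≢-nonZero (λ 2^n≡0 → contradiction (i^n≡0⇒i≡0 2ℤ n 2^n≡0) λ ())

twoAdic⁺ : ∀ n → TwoAdic (+ suc n)
twoAdic⁺ n = twoAdic (+ suc n) λ ()

oddPartMod2^ : ∀ m → ℕ → Fin ∣ 2ℤ ^ m ∣
oddPartMod2^ m zero    = residue (2ℤ ^ m) {{2^-nonZero m}} 0ℤ
oddPartMod2^ m (suc n) = residue (2ℤ ^ m) {{2^-nonZero m}} (TwoAdic.oddPart (twoAdic⁺ n))

partitionRegular⇒c≡A[mod8] : ∀ a b c A e → Odd a → Odd b → Odd c → Odd A →
  a + b ≡ 2ℤ ^ e * A → PartitionRegularXY a b (+ 2 * c) → + 8 ∣ c - A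
partitionRegular⇒c≡A[mod8] a b c A e odd-a odd-b odd-c odd-A a+b≡2^eA PR
  with PR ∣ 2ℤ ^ (2 ℕ.+ e) ∣ (oddPartMod2^ (2 ℕ.+ e))
... | suc x , suc y , suc z , _ , _ , _ , _ , same-colour , sol =
  solution⇒c≡A[mod8] a b c A (oddPart dx) (oddPart dy) (oddPart dz)
    e (exponent dx) (exponent dy) (exponent dz)
    odd-a odd-b odd-c odd-A (oddPart-odd dx) (oddPart-odd dy) (oddPart-odd dz) a+b≡2^eA
    (residue-≡⇒∣ (2ℤ ^ (2 ℕ.+ e)) {{2^-nonZero (2 ℕ.+ e)}} (oddPart dx) (oddPart dy) same-colour)
    (trans (cong₂ (λ X Y → a * X ² + b * Y ²) (sym (n≡2^e*q dx)) (sym (n≡2^e*q dy)))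
           (trans sol (cong (λ Z → + 2 * c * Z ²) (n≡2^e*q dz))))
  where
  open TwoAdic
  dx = twoAdic⁺ x
  dy = twoAdic⁺ y
  dz = twoAdic⁺ z

odd-part-of-square≡1[mod8] : ∀ {q M} i → Odd q → M ≢ 0ℤ → 2ℤ ^ i * q ≡ M ² → + 8 ∣ q - + 1
odd-part-of-square≡1[mod8] {q} {M} i odd-q M≢0 2^iq≡M² =
  let mkTwoAdic f μ odd-μ M≡2^fμ = twoAdic M M≢0
      μ²≡q : μ ² ≡ q
      μ²≡q = proj₂ (2^*odd-injective (2 ℕ.* f) i (odd-² {μ} odd-μ) odd-q
               (trans (sym (square-2^* f μ)) (trans (cong _² (sym M≡2^fμ)) (sym 2^iq≡M²))))
  in  subst (λ x → + 8 ∣ x - + 1) μ²≡q (odd²≡1[mod8] {μ} odd-μ)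

nonzeroSquare⇒abAc≡1[mod8] : ∀ a b c A e → Odd a → Odd b → Odd c → Odd A →
  a + b ≡ 2ℤ ^ e * A → NonzeroSquare (a * b * (a + b) * (+ 2 * c)) → + 8 ∣ a * b * A * c - + 1
nonzeroSquare⇒abAc≡1[mod8] a b c A e odd-a odd-b odd-c odd-A a+b≡2^eA (abc≢0 , M , abc≡M²) =
  odd-part-of-square≡1[mod8] (suc e) odd-abAc M≢0 (begin
    2ℤ ^ suc e * (a * b * A * c)       ≡⟨ regroup a b (2ℤ ^ e) A c ⟨
    a * b * (2ℤ ^ e * A) * (+ 2 * c)   ≡⟨ cong (λ s → a * b * s * (+ 2 * c)) a+b≡2^eA ⟨
    a * b * (a + b) * (+ 2 * c)        ≡⟨ abc≡M² ⟩
    M ²                                ∎)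
  where
  open ≡-Reasoning
  M≢0 : M ≢ 0ℤ
  M≢0 refl = abc≢0 abc≡M²
  odd-abAc : Odd (a * b * A * c)
  odd-abAc = odd-* {a * b * A} {c} (odd-* {a * b} {A} (odd-* {a} {b} odd-a odd-b) odd-A) odd-c
  regroup : ∀ a b E A c → a * b * (E * A) * (+ 2 * c) ≡ + 2 * E * (a * b * A * c)
  regroup = solve-∀

ab≡1[mod8] : ∀ a b c A → Odd c → + 8 ∣ c - A → + 8 ∣ a * b * A * c - + 1 → + 8 ∣ a * b - + 1
ab≡1[mod8] a b c A odd-c 8∣c-A 8∣abAc-1 =
  subst (+ 8 ∣_) (regroup a b c A)
    (∣m∣n⇒∣m-n (∣m∣n⇒∣m+n 8∣abAc-1 (∣n⇒∣m*n (a * b * c) 8∣c-A))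
               (∣n⇒∣m*n (a * b) (odd²≡1[mod8] {c} odd-c)))
  where
  regroup : ∀ a b c A →
    a * b * A * c - + 1 + a * b * c * (c - A) - a * b * (c * c - + 1) ≡ a * b - + 1
  regroup = solve-∀

≡2[mod4]⇒2*odd : ∀ {c} → CongMod (+ 4) c (+ 2) → ∃[ c′ ] Odd c′ × c ≡ + 2 * c′
≡2[mod4]⇒2*odd {c} c≡2[mod4] =
  let divides q c-2≡q*4 = ∣ᵤ⇒∣ {+ 4} {c - + 2} c≡2[mod4]
  in  + 1 + + 2 * q , 1+2*-odd q , (begin
        c                      ≡⟨ c≡[c-2]+2 c ⟩
        c - + 2 + + 2          ≡⟨ cong (_+ + 2) c-2≡q*4 ⟩
        q * + 4 + + 2          ≡⟨ regroup q ⟩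
        + 2 * (+ 1 + + 2 * q)  ∎)
  where
  open ≡-Reasoning
  c≡[c-2]+2 : ∀ c → c ≡ c - + 2 + + 2
  c≡[c-2]+2 = solve-∀
  regroup : ∀ q → q * + 4 + + 2 ≡ + 2 * (+ 1 + + 2 * q)
  regroup = solve-∀

proposition1p21 : (a b c : ℤ) → Odd a → Odd b → CongMod (+ 4) c (+ 2) →
    NonzeroSquare (a * b * (a + b) * c) →
    PartitionRegularXY a b c →
    CongMod (+ 8) (a * b) (+ 1)
proposition1p21 a b c odd-a odd-b c≡2[mod4] square PR
  with ≡2[mod4]⇒2*odd {c} c≡2[mod4]
... | c′ , odd-c′ , refl = ∣⇒∣ᵤ (ab≡1[mod8] a b c′ A odd-c′
        (partitionRegular⇒c≡A[mod8] a b c′ A e odd-a odd-b odd-c′ odd-A a+b≡2^eA PR)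
        (nonzeroSquare⇒abAc≡1[mod8] a b c′ A e odd-a odd-b odd-c′ odd-A a+b≡2^eA square))
  where
  absorb : ∀ a b c′ → a * b * + 0 * (+ 2 * c′) ≡ + 0
  absorb = solve-∀
  a+b≢0 : a + b ≢ 0ℤ
  a+b≢0 a+b≡0 =
    proj₁ square (trans (cong (λ s → a * b * s * (+ 2 * c′)) a+b≡0) (absorb a b c′))
  open TwoAdic (twoAdic (a + b) a+b≢0)
    renaming (exponent to e; oddPart to A; oddPart-odd to odd-A; n≡2^e*q to a+b≡2^eA)
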